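{- Let $\varrho\in\mathcal{R}_p(1)$ and let $v,d\ge 0$. Then the map $f_\varrho:\mathbf{E}\langle v,d\rangle\to\mathbf{E}\langle v,d\rangle$, $f_\varrho(\xi)=\xi*\varrho$ (taken as the element of $\mathbf{E}[v,d]$ containing $\xi*\varrho$), is well defined (sends characteristic minmatrices to characteristic minmatrices) and is a lattice automorphism of $\mathbf{E}\langle v,d\rangle$.
   Context: Language: propositional variables $p_1,p_2,\dots$, constants $0,1$, connectives $\neg,\vee$ (others as abbreviations), modal operator $\lozenge$, $\square\varphi:=\neg\lozenge\neg\varphi$. $\mathbf{E}$ is the smallest set of formulas containing all propositional tautologies and closed under modus ponens, uniform substitution and the rule RE: from $\varphi\leftrightarrow\psi$ infer $\lozenge\varphi\leftrightarrow\lozenge\psi$. A classical modal logic is a set of formulas containing $\mathbf{E}$ closed under these three rules. $\varphi\approx\psi$ means $\vdash_{\mathbf{E}}\varphi\leftrightarrow\psi$. The modal degree of a formula is the maximal nesting depth of $\lozenge$; $\mathcal{F}(v,d)$ is the set of formulas in variables among $p_1,\dots,p_v$ of modal degree $\le d$, and $\mathbf{E}[v,d]=\mathcal{F}(v,d)/\approx$, a finite Boolean algebra ordered by $\mathbf{E}$-provable implication. Characteristic minmatrices: for a classical modal logic $\mathbf{S}$, its characteristic minmatrix $\langle\mathbf{S}\rangle_{v,d}\in\mathbf{E}[v,d]$ is the class of the conjunction of all $\mathbf{S}$-theorems in $\mathcal{F}(v,d)$ (finitely many up to $\approx$). $\mathbf{E}\langle v,d\rangle$ is the set of all such $\langle\mathbf{S}\rangle_{v,d}$,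 ordered by $\mathbf{E}$-provable implication (equivalently inclusion of sets of canonical minterms); it is regarded as a lattice under this order. Uniform replacements: a UR is a formula $\rho(e)$ of modal degree $\le1$ in one variable $e$. $\varphi*\rho$ is defined recursively: $0*\rho=0$, $1*\rho=1$, $p_i*\rho=p_i$, $(\psi\vee\theta)*\rho=(\psi*\rho)\vee(\theta*\rho)$, $(\neg\psi)*\rho=\neg(\psi*\rho)$, $(\lozenge\psi)*\rho=\rho(\psi*\rho)$ (substitute $\psi*\rho$ for $e$ in $\rho$). $\mathcal{R}_p(1)$ is the set of 24 URs: $\lambda\leftrightarrow\tau$ with $\lambda\in\{\lozenge e,\neg\lozenge e\}$, $\tau\in\{1,e,e\vee\lozenge\neg e,e\vee\neg\lozenge\neg e,\neg e\vee\lozenge\neg e,\neg e\vee\neg\lozenge\neg e\}$, and $\lambda\leftrightarrow\tau$ with $\lambda\in\{\lozenge\neg e,\neg\lozenge\neg e\}$, $\tau\in\{1,e,e\vee\lozenge e,e\vee\neg\lozenge e,\neg e\vee\lozenge e,\neg e\vee\neg\lozenge e\}$. -}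

module Defs where

open import Data.Nat using (ℕ; zero; suc; _≤_; _<_; _⊔_)
open import Data.Bool using (Bool; true; false; not; _∨_)
open import Data.Fin using (Fin; zero; suc)
open import Data.Product using (Σ; _×_)
open import Relation.Binary.PropositionalEquality using (_≡_)

-- Formulas: variables p_i (indexed from 0, so p_1,…,p_v are var 0,…,var (v-1)),
-- constants 0,1, connectives ¬, ∨, modal operator ◇.
infixr 30 ¬′_ ◇_
infixl 20 _∨′_ _∧′_
infixr 15 _⇒_
infix 12 _⟺_

data Fm : Set where
  var  : ℕ → Fm
  𝟘 𝟙  : Fm
  ¬′_  : Fm → Fm
  _∨′_ : Fm → Fm → Fm
  ◇_   : Fm → Fm

_∧′_ : Fm → Fm → Fm
φ ∧′ ψ = ¬′ (¬′ φ ∨′ ¬′ ψ)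

_⇒_ : Fm → Fm → Fm
φ ⇒ ψ = ¬′ φ ∨′ ψ

_⟺_ : Fm → Fm → Fm
φ ⟺ ψ = (φ ⇒ ψ) ∧′ (ψ ⇒ φ)

□_ : Fm → Fm
□ φ = ¬′ ◇ ¬′ φ

-- Boolean evaluation, treating variables and ◇-formulas as atoms
eval : (ℕ → Bool) → (Fm → Bool) → Fm → Bool
eval V W (var i)  = V i
eval V W 𝟘        = false
eval V W 𝟙        = true
eval V W (¬′ φ)   = not (eval V W φ)
eval V W (φ ∨′ ψ) = eval V W φ ∨ eval V W ψ
eval V W (◇ φ)    = W φ

Taut : Fm → Set
Taut φ = ∀ (V : ℕ → Bool) (W : Fm → Bool) → eval V W φ ≡ true

sub : (ℕ → Fm) → Fm → Fm
sub σ (var i)  = σ i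
sub σ 𝟘        = 𝟘
sub σ 𝟙        = 𝟙
sub σ (¬′ φ)   = ¬′ sub σ φ
sub σ (φ ∨′ ψ) = sub σ φ ∨′ sub σ ψ
sub σ (◇ φ)    = ◇ sub σ φ

data ⊢E_ : Fm → Set where
  taut : ∀ {φ} → Taut φ → ⊢E φ
  mp   : ∀ {φ ψ} → ⊢E φ → ⊢E (φ ⇒ ψ) → ⊢E ψ
  usub : ∀ {φ} (σ : ℕ → Fm) → ⊢E φ → ⊢E sub σ φ
  re   : ∀ {φ ψ} → ⊢E (φ ⟺ ψ) → ⊢E (◇ φ ⟺ ◇ ψ)

record IsClassical (S : Fm → Set) : Set where
  field
    containsE : ∀ {φ} → ⊢E φ → S φ
    closedMP  : ∀ {φ ψ} → S φ → S (φ ⇒ ψ) → S ψ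
    closedUS  : ∀ {φ} (σ : ℕ → Fm) → S φ → S (sub σ φ)
    closedRE  : ∀ {φ ψ} → S (φ ⟺ ψ) → S (◇ φ ⟺ ◇ ψ)

md : Fm → ℕ
md (var i)  = 0
md 𝟘        = 0
md 𝟙        = 0
md (¬′ φ)   = md φ
md (φ ∨′ ψ) = md φ ⊔ md ψ
md (◇ φ)    = suc (md φ)

VarsBelow : ℕ → Fm → Set
VarsBelow v (var i)  = i < v
VarsBelow v 𝟘        = Data.Unit.⊤ where import Data.Unit
VarsBelow v 𝟙        = Data.Unit.⊤ where import Data.Unit
VarsBelow v (¬′ φ)   = VarsBelow v φ
VarsBelow v (φ ∨′ ψ) = VarsBelow v φ × VarsBelow v ψ
VarsBelow v (◇ φ)    = VarsBelow v φ

InF : ℕ → ℕ → Fm → Set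
InF v d φ = VarsBelow v φ × md φ ≤ d

-- ξ represents the characteristic minmatrix ⟨S⟩_{v,d} of some classical
-- modal logic S: ξ ∈ 𝓕(v,d), ξ is an S-theorem, and ξ E-provably implies
-- every S-theorem in 𝓕(v,d) (so ξ ≈ conjunction of all S-theorems in 𝓕(v,d)).
CharMin : ℕ → ℕ → Fm → Set₁
CharMin v d ξ = Σ (Fm → Set) λ S →
  IsClassical S × InF v d ξ × S ξ ×
  (∀ φ → InF v d φ → S φ → ⊢E (ξ ⇒ φ))

-- uniform replacements: ρ is a formula in the single variable e = var 0;
-- ρ(ψ) is obtained by substituting ψ for e.
_⟨_⟩ : Fm → Fm → Fm
ρ ⟨ ψ ⟩ = sub (λ _ → ψ) ρ

infixl 25 _*_
_*_ : Fm → Fm → Fm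
var i    * ρ = var i
𝟘        * ρ = 𝟘
𝟙        * ρ = 𝟙
(¬′ ψ)   * ρ = ¬′ (ψ * ρ)
(ψ ∨′ θ) * ρ = (ψ * ρ) ∨′ (θ * ρ)
(◇ ψ)    * ρ = ρ ⟨ ψ * ρ ⟩

e : Fm
e = var 0

lamA : Fin 2 → Fm
lamA zero    = ◇ e
lamA (suc _) = ¬′ ◇ e

tauA : Fin 6 → Fm
tauA zero                               = 𝟙
tauA (suc zero)                         = e
tauA (suc (suc zero))                   = e ∨′ ◇ ¬′ e
tauA (suc (suc (suc zero)))             = e ∨′ ¬′ ◇ ¬′ e
tauA (suc (suc (suc (suc zero))))       = ¬′ e ∨′ ◇ ¬′ e
tauA (suc (suc (suc (suc (suc _)))))    = ¬′ e ∨′ ¬′ ◇ ¬′ e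

lamB : Fin 2 → Fm
lamB zero    = ◇ ¬′ e
lamB (suc _) = ¬′ ◇ ¬′ e

tauB : Fin 6 → Fm
tauB zero                               = 𝟙
tauB (suc zero)                         = e
tauB (suc (suc zero))                   = e ∨′ ◇ e
tauB (suc (suc (suc zero)))             = e ∨′ ¬′ ◇ e
tauB (suc (suc (suc (suc zero))))       = ¬′ e ∨′ ◇ e
tauB (suc (suc (suc (suc (suc _)))))    = ¬′ e ∨′ ¬′ ◇ e

data Rp1 : Fm → Set where
  groupA : (l : Fin 2) (t : Fin 6) → Rp1 (lamA l ⟺ tauA t)
  groupB : (l : Fin 2) (t : Fin 6) → Rp1 (lamB l ⟺ tauB t)

-- Every ρ ∈ 𝓡_p(1) has an inverse ρ′ ∈ 𝓡_p(1), i.e. ρ * ρ′ ≈ ◇ e ≈ ρ′ * ρ, which is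
-- checked by truth tables.  Replacement by any UR maps E-theorems to E-theorems and
-- pulls a classical logic S back to the classical logic {φ | S ⊢ φ * ρ′}; a UR of modal
-- degree ≤ 1 keeps 𝓕(v,d) invariant, so the characteristic minmatrix of that logic is
-- ξ * ρ when ξ is the one of S.  Since φ * ρ * ρ′ ≈ φ, f_ρ′ is inverse to f_ρ, and both
-- are monotone.
module Submission where

open import Defs
open import Data.Nat using (ℕ; suc; _+_; _≤_; z≤n; s≤s)
open import Data.Nat.Properties using (≤-trans; ≤-refl; +-mono-≤; +-monoˡ-≤; ⊔-mono-≤; ⊔-lub; m≤m⊔n; m≤n⊔m)
open import Data.Bool using (Bool; true; false; not) renaming (_∨_ to _∨ᵇ_)
open import Data.Bool.Properties using (¬-not) renaming (_≟_ to _≟ᵇ_)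
open import Data.Fin using (Fin)
open import Data.Fin.Patterns using (0F; 1F; 2F; 3F; 4F; 5F)
open import Data.Fin.Subset.Properties using (anySubset?)
open import Data.Product using (Σ; ∃; _×_; _,_; -,_; proj₁; proj₂)
open import Data.Vec using (Vec; []; _∷_; lookup; map)
open import Data.Vec.Properties using (lookup-map)
open import Relation.Binary.PropositionalEquality using (_≡_; refl; sym; trans; cong; cong₂; subst)
open import Relation.Nullary.Decidable using (Dec; True; ¬?; toWitness)
open import Relation.Nullary.Negation using (¬_; ¬∃⟶∀¬)

-- Propositional tautologies decided by truth tables

infixr 30 ¬ˢ_
infixl 20 _∨ˢ_

data Schema (n : ℕ) : Set where
  x    : Fin n → Schema n
  ⊥ˢ ⊤ˢ : Schema n
  ¬ˢ_  : Schema n → Schema n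
  _∨ˢ_ : Schema n → Schema n → Schema n

module _ {n : ℕ} where

  infixl 20 _∧ˢ_
  infixr 15 _⇒ˢ_
  infix 12 _⟺ˢ_

  _∧ˢ_ _⇒ˢ_ _⟺ˢ_ : Schema n → Schema n → Schema n
  s ∧ˢ t = ¬ˢ (¬ˢ s ∨ˢ ¬ˢ t)
  s ⇒ˢ t = ¬ˢ s ∨ˢ t
  s ⟺ˢ t = (s ⇒ˢ t) ∧ˢ (t ⇒ˢ s)

  instantiate : Vec Fm n → Schema n → Fm
  instantiate φs (x i)    = lookup φs i
  instantiate φs ⊥ˢ       = 𝟘
  instantiate φs ⊤ˢ       = 𝟙
  instantiate φs (¬ˢ s)   = ¬′ instantiate φs s
  instantiate φs (s ∨ˢ t) = instantiate φs s ∨′ instantiate φs t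

  evalˢ : Vec Bool n → Schema n → Bool
  evalˢ bs (x i)    = lookup bs i
  evalˢ bs ⊥ˢ       = false
  evalˢ bs ⊤ˢ       = true
  evalˢ bs (¬ˢ s)   = not (evalˢ bs s)
  evalˢ bs (s ∨ˢ t) = evalˢ bs s ∨ᵇ evalˢ bs t

  eval-instantiate : ∀ V W φs s → eval V W (instantiate φs s) ≡ evalˢ (map (eval V W) φs) s
  eval-instantiate V W φs (x i)    = sym (lookup-map i (eval V W) φs)
  eval-instantiate V W φs ⊥ˢ       = refl
  eval-instantiate V W φs ⊤ˢ       = refl
  eval-instantiate V W φs (¬ˢ s)   = cong not (eval-instantiate V W φs s)
  eval-instantiate V W φs (s ∨ˢ t) = cong₂ _∨ᵇ_ (eval-instantiate V W φs s) (eval-instantiate V W φs t)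

  tautology? : (s : Schema n) → Dec (¬ ∃ λ bs → evalˢ bs s ≡ false)
  tautology? s = ¬? (anySubset? (λ bs → evalˢ bs s ≟ᵇ false))

  ⊢E-instantiate : (s : Schema n) {valid : True (tautology? s)} (φs : Vec Fm n) →
                   ⊢E instantiate φs s
  ⊢E-instantiate s {valid} φs = taut λ V W →
    trans (eval-instantiate V W φs s)
          (¬-not (¬∃⟶∀¬ (toWitness valid) (map (eval V W) φs)))

x₀ : ∀ {n} → Schema (suc n)
x₀ = x 0F

x₁ : ∀ {n} → Schema (suc (suc n))
x₁ = x 1F

x₂ : ∀ {n} → Schema (suc (suc (suc n)))
x₂ = x 2F

x₃ : ∀ {n} → Schema (suc (suc (suc (suc n))))
x₃ = x 3F

⊢E-isClassical : IsClassical ⊢E_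
⊢E-isClassical = record { containsE = λ ⊢φ → ⊢φ ; closedMP = mp ; closedUS = usub ; closedRE = re }

module ClassicalRules {S : Fm → Set} (isClassical : IsClassical S) where
  open IsClassical isClassical

  ⟺-refl : ∀ {a} → S (a ⟺ a)
  ⟺-refl {a} = containsE (⊢E-instantiate (x₀ ⟺ˢ x₀) (a ∷ []))

  ⟺-sym : ∀ {a b} → S (a ⟺ b) → S (b ⟺ a)
  ⟺-sym {a} {b} a⟺b =
    closedMP a⟺b (containsE (⊢E-instantiate ((x₀ ⟺ˢ x₁) ⇒ˢ (x₁ ⟺ˢ x₀)) (a ∷ b ∷ [])))

  ⟺-trans : ∀ {a b c} → S (a ⟺ b) → S (b ⟺ c) → S (a ⟺ c)
  ⟺-trans {a} {b} {c} a⟺b b⟺c = closedMP b⟺c (closedMP a⟺b (containsE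
    (⊢E-instantiate ((x₀ ⟺ˢ x₁) ⇒ˢ (x₁ ⟺ˢ x₂) ⇒ˢ (x₀ ⟺ˢ x₂)) (a ∷ b ∷ c ∷ []))))

  ⟺-mp : ∀ {a b} → S (a ⟺ b) → S a → S b
  ⟺-mp {a} {b} a⟺b Sa = closedMP Sa (closedMP a⟺b (containsE
    (⊢E-instantiate ((x₀ ⟺ˢ x₁) ⇒ˢ (x₀ ⇒ˢ x₁)) (a ∷ b ∷ []))))

  ¬-cong : ∀ {a b} → S (a ⟺ b) → S (¬′ a ⟺ ¬′ b)
  ¬-cong {a} {b} a⟺b =
    closedMP a⟺b (containsE (⊢E-instantiate ((x₀ ⟺ˢ x₁) ⇒ˢ (¬ˢ x₀ ⟺ˢ ¬ˢ x₁)) (a ∷ b ∷ [])))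

  ∨-cong : ∀ {a b c d} → S (a ⟺ b) → S (c ⟺ d) → S (a ∨′ c ⟺ b ∨′ d)
  ∨-cong {a} {b} {c} {d} a⟺b c⟺d = closedMP c⟺d (closedMP a⟺b (containsE (⊢E-instantiate
    ((x₀ ⟺ˢ x₁) ⇒ˢ (x₂ ⟺ˢ x₃) ⇒ˢ (x₀ ∨ˢ x₂ ⟺ˢ x₁ ∨ˢ x₃)) (a ∷ b ∷ c ∷ d ∷ []))))

  ⇒-resp-⟺ : ∀ {a b c d} → S (a ⟺ b) → S (c ⟺ d) → S (a ⇒ c) → S (b ⇒ d)
  ⇒-resp-⟺ {a} {b} {c} {d} a⟺b c⟺d a⇒c = closedMP a⇒c (closedMP c⟺d (closedMP a⟺b
    (containsE (⊢E-instantiate ((x₀ ⟺ˢ x₁) ⇒ˢ (x₂ ⟺ˢ x₃) ⇒ˢ (x₀ ⇒ˢ x₂) ⇒ˢ (x₁ ⇒ˢ x₃))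
                               (a ∷ b ∷ c ∷ d ∷ [])))))

  ⟨⟩-cong : ∀ {a b} → S (a ⟺ b) → ∀ ρ → S (ρ ⟨ a ⟩ ⟺ ρ ⟨ b ⟩)
  ⟨⟩-cong a⟺b (var i)  = a⟺b
  ⟨⟩-cong a⟺b 𝟘        = ⟺-refl
  ⟨⟩-cong a⟺b 𝟙        = ⟺-refl
  ⟨⟩-cong a⟺b (¬′ ρ)   = ¬-cong (⟨⟩-cong a⟺b ρ)
  ⟨⟩-cong a⟺b (ρ ∨′ σ) = ∨-cong (⟨⟩-cong a⟺b ρ) (⟨⟩-cong a⟺b σ)
  ⟨⟩-cong a⟺b (◇ ρ)    = closedRE (⟨⟩-cong a⟺b ρ)

open ClassicalRules ⊢E-isClassical

sub-cong : ∀ {σ τ} → (∀ i → σ i ≡ τ i) → ∀ φ → sub σ φ ≡ sub τ φ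
sub-cong σ≗τ (var i)  = σ≗τ i
sub-cong σ≗τ 𝟘        = refl
sub-cong σ≗τ 𝟙        = refl
sub-cong σ≗τ (¬′ φ)   = cong ¬′_ (sub-cong σ≗τ φ)
sub-cong σ≗τ (φ ∨′ ψ) = cong₂ _∨′_ (sub-cong σ≗τ φ) (sub-cong σ≗τ ψ)
sub-cong σ≗τ (◇ φ)    = cong ◇_ (sub-cong σ≗τ φ)

sub-sub : ∀ σ τ φ → sub τ (sub σ φ) ≡ sub (λ i → sub τ (σ i)) φ
sub-sub σ τ (var i)  = refl
sub-sub σ τ 𝟘        = refl
sub-sub σ τ 𝟙        = refl
sub-sub σ τ (¬′ φ)   = cong ¬′_ (sub-sub σ τ φ)
sub-sub σ τ (φ ∨′ ψ) = cong₂ _∨′_ (sub-sub σ τ φ) (sub-sub σ τ ψ)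
sub-sub σ τ (◇ φ)    = cong ◇_ (sub-sub σ τ φ)

sub-* : ∀ ρ σ φ → sub σ φ * ρ ≡ sub (λ i → σ i * ρ) (φ * ρ)
sub-* ρ σ (var i)  = refl
sub-* ρ σ 𝟘        = refl
sub-* ρ σ 𝟙        = refl
sub-* ρ σ (¬′ φ)   = cong ¬′_ (sub-* ρ σ φ)
sub-* ρ σ (φ ∨′ ψ) = cong₂ _∨′_ (sub-* ρ σ φ) (sub-* ρ σ ψ)
sub-* ρ σ (◇ φ)    = trans (sub-cong (λ _ → sub-* ρ σ φ) ρ)
                           (sym (sub-sub (λ _ → φ * ρ) (λ i → σ i * ρ) ρ))

eval-* : ∀ ρ V W φ → eval V W (φ * ρ) ≡ eval V (λ ψ → eval V W (ρ ⟨ ψ * ρ ⟩)) φ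
eval-* ρ V W (var i)  = refl
eval-* ρ V W 𝟘        = refl
eval-* ρ V W 𝟙        = refl
eval-* ρ V W (¬′ φ)   = cong not (eval-* ρ V W φ)
eval-* ρ V W (φ ∨′ ψ) = cong₂ _∨ᵇ_ (eval-* ρ V W φ) (eval-* ρ V W ψ)
eval-* ρ V W (◇ φ)    = refl

⊢E-* : ∀ ρ {φ} → ⊢E φ → ⊢E (φ * ρ)
⊢E-* ρ (taut {φ} valid)    = taut λ V W → trans (eval-* ρ V W φ) (valid V _)
⊢E-* ρ (mp ⊢φ ⊢φ⇒ψ)        = mp (⊢E-* ρ ⊢φ) (⊢E-* ρ ⊢φ⇒ψ)
⊢E-* ρ (usub {φ} σ ⊢φ)     = subst ⊢E_ (sym (sub-* ρ σ φ)) (usub _ (⊢E-* ρ ⊢φ))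
⊢E-* ρ (re ⊢φ⟺ψ)           = ⟨⟩-cong (⊢E-* ρ ⊢φ⟺ψ) ρ

*-preimage-isClassical : ∀ {S} → IsClassical S → ∀ ρ → IsClassical (λ φ → S (φ * ρ))
*-preimage-isClassical {S} isClassical ρ = record
  { containsE = λ ⊢φ → containsE (⊢E-* ρ ⊢φ)
  ; closedMP  = closedMP
  ; closedUS  = λ {φ} σ Sφ → subst S (sym (sub-* ρ σ φ)) (closedUS _ Sφ)
  ; closedRE  = λ S[φ⟺ψ] → ClassicalRules.⟨⟩-cong isClassical S[φ⟺ψ] ρ
  }
  where open IsClassical isClassical

-- Uniform replacements of modal degree ≤ 1 keep 𝓕(v,d) invariant

md-sub : ∀ {k σ} → (∀ i → md (σ i) ≤ k) → ∀ φ → md (sub σ φ) ≤ md φ + k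
md-sub md[σ]≤k (var i)      = md[σ]≤k i
md-sub md[σ]≤k 𝟘            = z≤n
md-sub md[σ]≤k 𝟙            = z≤n
md-sub md[σ]≤k (¬′ φ)       = md-sub md[σ]≤k φ
md-sub {k} md[σ]≤k (φ ∨′ ψ) = ⊔-lub
  (≤-trans (md-sub md[σ]≤k φ) (+-monoˡ-≤ k (m≤m⊔n (md φ) (md ψ))))
  (≤-trans (md-sub md[σ]≤k ψ) (+-monoˡ-≤ k (m≤n⊔m (md φ) (md ψ))))
md-sub md[σ]≤k (◇ φ)        = s≤s (md-sub md[σ]≤k φ)

md-* : ∀ {ρ} → md ρ ≤ 1 → ∀ φ → md (φ * ρ) ≤ md φ
md-* md[ρ]≤1 (var i)  = z≤n
md-* md[ρ]≤1 𝟘        = z≤n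
md-* md[ρ]≤1 𝟙        = z≤n
md-* md[ρ]≤1 (¬′ φ)   = md-* md[ρ]≤1 φ
md-* md[ρ]≤1 (φ ∨′ ψ) = ⊔-mono-≤ (md-* md[ρ]≤1 φ) (md-* md[ρ]≤1 ψ)
md-* {ρ} md[ρ]≤1 (◇ φ) =
  ≤-trans (md-sub {md (φ * ρ)} (λ _ → ≤-refl) ρ) (+-mono-≤ md[ρ]≤1 (md-* md[ρ]≤1 φ))

VarsBelow-sub : ∀ {v σ} → (∀ i → VarsBelow v (σ i)) → ∀ φ → VarsBelow v (sub σ φ)
VarsBelow-sub vb[σ] (var i)  = vb[σ] i
VarsBelow-sub vb[σ] 𝟘        = _
VarsBelow-sub vb[σ] 𝟙        = _
VarsBelow-sub vb[σ] (¬′ φ)   = VarsBelow-sub vb[σ] φ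
VarsBelow-sub vb[σ] (φ ∨′ ψ) = VarsBelow-sub vb[σ] φ , VarsBelow-sub vb[σ] ψ
VarsBelow-sub vb[σ] (◇ φ)    = VarsBelow-sub vb[σ] φ

VarsBelow-* : ∀ {v} ρ φ → VarsBelow v φ → VarsBelow v (φ * ρ)
VarsBelow-* ρ (var i)  vb          = vb
VarsBelow-* ρ 𝟘        vb          = vb
VarsBelow-* ρ 𝟙        vb          = vb
VarsBelow-* ρ (¬′ φ)   vb          = VarsBelow-* ρ φ vb
VarsBelow-* ρ (φ ∨′ ψ) (vbφ , vbψ) = VarsBelow-* ρ φ vbφ , VarsBelow-* ρ ψ vbψ
VarsBelow-* ρ (◇ φ)    vb          = VarsBelow-sub (λ _ → VarsBelow-* ρ φ vb) ρ

InF-* : ∀ {v d ρ} → md ρ ≤ 1 → ∀ φ → InF v d φ → InF v d (φ * ρ)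
InF-* {ρ = ρ} md[ρ]≤1 φ (vb , md≤d) = VarsBelow-* ρ φ vb , ≤-trans (md-* md[ρ]≤1 φ) md≤d

record AreInverse (ρ ρ′ : Fm) : Set where
  field
    md[ρ]≤1  : md ρ ≤ 1
    md[ρ′]≤1 : md ρ′ ≤ 1
    ρ*ρ′≈◇e  : ⊢E (ρ * ρ′ ⟺ ◇ e)
    ρ′*ρ≈◇e  : ⊢E (ρ′ * ρ ⟺ ◇ e)

AreInverse-sym : ∀ {ρ ρ′} → AreInverse ρ ρ′ → AreInverse ρ′ ρ
AreInverse-sym ρ↔ρ′ = record
  { md[ρ]≤1 = md[ρ′]≤1 ; md[ρ′]≤1 = md[ρ]≤1 ; ρ*ρ′≈◇e = ρ′*ρ≈◇e ; ρ′*ρ≈◇e = ρ*ρ′≈◇e }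
  where open AreInverse ρ↔ρ′

*-inverseˡ : ∀ {ρ ρ′} → AreInverse ρ ρ′ → ∀ φ → ⊢E (φ * ρ * ρ′ ⟺ φ)
*-inverseˡ ρ↔ρ′ (var i)  = ⟺-refl
*-inverseˡ ρ↔ρ′ 𝟘        = ⟺-refl
*-inverseˡ ρ↔ρ′ 𝟙        = ⟺-refl
*-inverseˡ ρ↔ρ′ (¬′ φ)   = ¬-cong (*-inverseˡ ρ↔ρ′ φ)
*-inverseˡ ρ↔ρ′ (φ ∨′ ψ) = ∨-cong (*-inverseˡ ρ↔ρ′ φ) (*-inverseˡ ρ↔ρ′ ψ)
*-inverseˡ {ρ} {ρ′} ρ↔ρ′ (◇ φ) =
  subst (λ χ → ⊢E (χ ⟺ ◇ φ)) (sym (sub-* ρ′ (λ _ → φ * ρ) ρ))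
    (⟺-trans (usub (λ _ → φ * ρ * ρ′) (AreInverse.ρ*ρ′≈◇e ρ↔ρ′)) (re (*-inverseˡ ρ↔ρ′ φ)))

*-reflects-⇒ : ∀ {ρ ρ′} → AreInverse ρ ρ′ → ∀ {φ ψ} → ⊢E (φ * ρ ⇒ ψ * ρ) → ⊢E (φ ⇒ ψ)
*-reflects-⇒ {ρ′ = ρ′} ρ↔ρ′ {φ} {ψ} φρ⇒ψρ =
  ⇒-resp-⟺ (*-inverseˡ ρ↔ρ′ φ) (*-inverseˡ ρ↔ρ′ ψ) (⊢E-* ρ′ φρ⇒ψρ)

-- ξ * ρ is the characteristic minmatrix of {φ | S ⊢ φ * ρ′}.
CharMin-* : ∀ {ρ ρ′ v d ξ} → AreInverse ρ ρ′ → CharMin v d ξ → CharMin v d (ξ * ρ)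
CharMin-* {ρ} {ρ′} {ξ = ξ} ρ↔ρ′ (S , isClassical , ξ∈F , Sξ , ξ-least) =
  (λ φ → S (φ * ρ′)) , *-preimage-isClassical isClassical ρ′ ,
  InF-* md[ρ]≤1 ξ ξ∈F ,
  ClassicalRules.⟺-mp isClassical (IsClassical.containsE isClassical (⟺-sym (*-inverseˡ ρ↔ρ′ ξ))) Sξ ,
  λ φ φ∈F Sφρ′ → ⇒-resp-⟺ ⟺-refl (*-inverseˡ (AreInverse-sym ρ↔ρ′) φ)
                   (⊢E-* ρ (ξ-least (φ * ρ′) (InF-* md[ρ′]≤1 φ φ∈F) Sφρ′))
  where open AreInverse ρ↔ρ′

md-⟺ : ∀ {k} a b → md a ≤ k → md b ≤ k → md (a ⟺ b) ≤ k
md-⟺ a b md[a]≤k md[b]≤k = ⊔-lub (⊔-lub md[a]≤k md[b]≤k) (⊔-lub md[b]≤k md[a]≤k)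

md-lamA : ∀ l → md (lamA l) ≤ 1
md-lamA 0F = s≤s z≤n
md-lamA 1F = s≤s z≤n

md-lamB : ∀ l → md (lamB l) ≤ 1
md-lamB 0F = s≤s z≤n
md-lamB 1F = s≤s z≤n

md-tauA : ∀ t → md (tauA t) ≤ 1
md-tauA 0F = z≤n
md-tauA 1F = z≤n
md-tauA 2F = s≤s z≤n
md-tauA 3F = s≤s z≤n
md-tauA 4F = s≤s z≤n
md-tauA 5F = s≤s z≤n

md-tauB : ∀ t → md (tauB t) ≤ 1
md-tauB 0F = z≤n
md-tauB 1F = z≤n
md-tauB 2F = s≤s z≤n
md-tauB 3F = s≤s z≤n
md-tauB 4F = s≤s z≤n
md-tauB 5F = s≤s z≤n

Rp1⇒md≤1 : ∀ {ρ} → Rp1 ρ → md ρ ≤ 1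
Rp1⇒md≤1 (groupA l t) = md-⟺ (lamA l) (tauA t) (md-lamA l) (md-tauA t)
Rp1⇒md≤1 (groupB l t) = md-⟺ (lamB l) (tauB t) (md-lamB l) (md-tauB t)

inverseA : Fin 2 → Fin 6 → Fin 2 × Fin 6
inverseA 0F t  = 0F , t
inverseA 1F 0F = 1F , 0F
inverseA 1F 1F = 1F , 1F
inverseA 1F 2F = 1F , 3F
inverseA 1F 3F = 1F , 2F
inverseA 1F 4F = 1F , 5F
inverseA 1F 5F = 1F , 4F

inverseB : Fin 2 → Fin 6 → Fin 2 × Fin 6
inverseB 0F 0F = 0F , 0F
inverseB 0F 1F = 1F , 1F
inverseB 0F 2F = 0F , 4F
inverseB 0F 3F = 0F , 5F
inverseB 0F 4F = 0F , 2F
inverseB 0F 5F = 0F , 3F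
inverseB 1F 0F = 1F , 0F
inverseB 1F 1F = 0F , 1F
inverseB 1F 2F = 1F , 5F
inverseB 1F 3F = 1F , 4F
inverseB 1F 4F = 1F , 3F
inverseB 1F 5F = 1F , 2F

inverse : ∀ {ρ} → Rp1 ρ → Σ Fm Rp1
inverse (groupA l t) = -, groupA (proj₁ (inverseA l t)) (proj₂ (inverseA l t))
inverse (groupB l t) = -, groupB (proj₁ (inverseB l t)) (proj₂ (inverseB l t))

-- Truth tables over the atoms e, ◇ e, ◇ ¬ e, ◇ ¬ ¬ e, enough for compositions of elements of 𝓡_p(1).
abstractₑ : Fm → Schema 4
abstractₑ (var 0)         = x₀
abstractₑ (◇ var 0)       = x₁
abstractₑ (◇ ¬′ var 0)    = x₂
abstractₑ (◇ ¬′ ¬′ var 0) = x₃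
abstractₑ 𝟙               = ⊤ˢ
abstractₑ (¬′ φ)          = ¬ˢ abstractₑ φ
abstractₑ (φ ∨′ ψ)        = abstractₑ φ ∨ˢ abstractₑ ψ
abstractₑ _               = ⊥ˢ

⊢E-byTruthTable : (φ : Fm) → instantiate (e ∷ ◇ e ∷ ◇ ¬′ e ∷ ◇ ¬′ ¬′ e ∷ []) (abstractₑ φ) ≡ φ →
                  {valid : True (tautology? (abstractₑ φ))} → ⊢E φ
⊢E-byTruthTable φ abstraction-faithful {valid} =
  subst ⊢E_ abstraction-faithful (⊢E-instantiate (abstractₑ φ) {valid} _)

-- ◇ ¬ ¬ e and ◇ e are distinct atoms for truth tables; their equivalence needs RE.
inverse-laws : ∀ {ρ} (r : Rp1 ρ) → let ρ′ = proj₁ (inverse r) in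
               ⊢E ((◇ ¬′ ¬′ e ⟺ ◇ e) ⇒ (ρ * ρ′ ⟺ ◇ e) ∧′ (ρ′ * ρ ⟺ ◇ e))
inverse-laws (groupA 0F 0F) = ⊢E-byTruthTable _ refl
inverse-laws (groupA 0F 1F) = ⊢E-byTruthTable _ refl
inverse-laws (groupA 0F 2F) = ⊢E-byTruthTable _ refl
inverse-laws (groupA 0F 3F) = ⊢E-byTruthTable _ refl
inverse-laws (groupA 0F 4F) = ⊢E-byTruthTable _ refl
inverse-laws (groupA 0F 5F) = ⊢E-byTruthTable _ refl
inverse-laws (groupA 1F 0F) = ⊢E-byTruthTable _ refl
inverse-laws (groupA 1F 1F) = ⊢E-byTruthTable _ refl
inverse-laws (groupA 1F 2F) = ⊢E-byTruthTable _ refl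
inverse-laws (groupA 1F 3F) = ⊢E-byTruthTable _ refl
inverse-laws (groupA 1F 4F) = ⊢E-byTruthTable _ refl
inverse-laws (groupA 1F 5F) = ⊢E-byTruthTable _ refl
inverse-laws (groupB 0F 0F) = ⊢E-byTruthTable _ refl
inverse-laws (groupB 0F 1F) = ⊢E-byTruthTable _ refl
inverse-laws (groupB 0F 2F) = ⊢E-byTruthTable _ refl
inverse-laws (groupB 0F 3F) = ⊢E-byTruthTable _ refl
inverse-laws (groupB 0F 4F) = ⊢E-byTruthTable _ refl
inverse-laws (groupB 0F 5F) = ⊢E-byTruthTable _ refl
inverse-laws (groupB 1F 0F) = ⊢E-byTruthTable _ refl
inverse-laws (groupB 1F 1F) = ⊢E-byTruthTable _ refl
inverse-laws (groupB 1F 2F) = ⊢E-byTruthTable _ refl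
inverse-laws (groupB 1F 3F) = ⊢E-byTruthTable _ refl
inverse-laws (groupB 1F 4F) = ⊢E-byTruthTable _ refl
inverse-laws (groupB 1F 5F) = ⊢E-byTruthTable _ refl

◇¬¬e≈◇e : ⊢E (◇ ¬′ ¬′ e ⟺ ◇ e)
◇¬¬e≈◇e = re (⊢E-instantiate (¬ˢ ¬ˢ x₀ ⟺ˢ x₀) (e ∷ []))

Rp1-inverse : ∀ {ρ} (r : Rp1 ρ) → AreInverse ρ (proj₁ (inverse r))
Rp1-inverse {ρ} r = record
  { md[ρ]≤1  = Rp1⇒md≤1 r
  ; md[ρ′]≤1 = Rp1⇒md≤1 (proj₂ (inverse r))
  ; ρ*ρ′≈◇e  = mp laws (⊢E-instantiate (x₀ ∧ˢ x₁ ⇒ˢ x₀) (_ ∷ _ ∷ []))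
  ; ρ′*ρ≈◇e  = mp laws (⊢E-instantiate (x₀ ∧ˢ x₁ ⇒ˢ x₁) (_ ∷ _ ∷ []))
  }
  where
  laws : ⊢E ((ρ * proj₁ (inverse r) ⟺ ◇ e) ∧′ (proj₁ (inverse r) * ρ ⟺ ◇ e))
  laws = mp ◇¬¬e≈◇e (inverse-laws r)

theorem14 : (ρ : Fm) → Rp1 ρ → (v d : ℕ) →
    ((ξ : Fm) → CharMin v d ξ → CharMin v d (ξ * ρ))
    × ((ξ η : Fm) → CharMin v d ξ → CharMin v d η →
        ((⊢E (ξ ⇒ η) → ⊢E ((ξ * ρ) ⇒ (η * ρ)))
         × (⊢E ((ξ * ρ) ⇒ (η * ρ)) → ⊢E (ξ ⇒ η))))
    × ((η : Fm) → CharMin v d η →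
        Σ Fm (λ ξ → CharMin v d ξ × ⊢E ((ξ * ρ) ⟺ η)))
theorem14 ρ r v d =
  (λ ξ → CharMin-* ρ↔ρ′) ,
  (λ ξ η _ _ → ⊢E-* ρ , *-reflects-⇒ ρ↔ρ′) ,
  λ η η-char → η * ρ′ , CharMin-* ρ′↔ρ η-char , *-inverseˡ ρ′↔ρ η
  where
  ρ′ = proj₁ (inverse r)
  ρ↔ρ′ = Rp1-inverse r
  ρ′↔ρ = AreInverse-sym ρ↔ρ′
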